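{- Let $G$ be a 2-connected graph that has no $K_2$-cutset. If $G$ does not contain a propeller as an induced subgraph and $G$ contains the cycle $C_k$ as an induced subgraph for some $k\in\{3,4,5\}$, then $G=C_k$.
   Context: All graphs are finite, simple and undirected. $C_k$ denotes the cycle of length $k$. A propeller $(C,x)$ is a graph consisting of a chordless cycle $C$ (the rim) and a node $x\notin V(C)$ (the center) that has at least two neighbors on $C$. A graph is 2-connected if removing fewer than 2 nodes never leaves a disconnected graph or a single node. A $K_2$-cutset is a set $\{a,b\}$ with $ab\in E(G)$ such that $G\setminus\{a,b\}$ is disconnected. -}

module Defs where

open import Data.Nat using (ℕ; zero; suc; _≤_; _∸_; _≡ᵇ_; ∣_-_∣; s≤s; z≤n)
open import Data.Nat.Properties using (∣n-n∣≡0; ∣-∣-comm)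
open import Data.Bool using (Bool; true; false; _∨_)
open import Data.Unit using (⊤)
open import Data.Fin using (Fin; toℕ)
open import Data.Product using (Σ; _×_; _,_; ∃)
open import Relation.Binary.PropositionalEquality using (_≡_; _≢_; refl; cong₂)
open import Relation.Nullary using (¬_)
open import Function.Bundles using (_⤖_; Bijection)
open import Function.Definitions using (Injective)

record Graph : Set where
  field
    n     : ℕ
    E     : Fin n → Fin n → Bool
    sym   : ∀ u v → E u v ≡ E v u
    irref : ∀ v → E v v ≡ false

open Graph public

V : Graph → Set
V G = Fin (n G)

Adj : (G : Graph) → V G → V G → Set
Adj G u v = E G u v ≡ true

cycleE : (k : ℕ) → Fin k → Fin k → Bool
cycleE k i j = (∣ toℕ i - toℕ j ∣ ≡ᵇ 1) ∨ (∣ toℕ i - toℕ j ∣ ≡ᵇ (k ∸ 1))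

private
  cycle-irref : (k : ℕ) → 3 ≤ k → (i : Fin k) → cycleE k i i ≡ false
  cycle-irref (suc (suc (suc m))) _ i rewrite ∣n-n∣≡0 (toℕ i) = refl
  cycle-irref (suc zero) (s≤s ()) i
  cycle-irref (suc (suc zero)) (s≤s (s≤s ())) i

  cycle-sym : (k : ℕ) → (i j : Fin k) → cycleE k i j ≡ cycleE k j i
  cycle-sym k i j rewrite ∣-∣-comm (toℕ i) (toℕ j) = refl

Cycle : (k : ℕ) → 3 ≤ k → Graph
Cycle k p = record
  { n = k ; E = cycleE k ; sym = cycle-sym k ; irref = cycle-irref k p }

record InducedSub (H G : Graph) : Set where
  field
    emb    : V H → V G
    inj    : Injective _≡_ _≡_ emb
    adjPres : ∀ u v → E G (emb u) (emb v) ≡ E H u v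

record Iso (G H : Graph) : Set where
  field
    bij     : V G ⤖ V H
    adjPres : ∀ u v → E H (Bijection.to bij u) (Bijection.to bij v) ≡ E G u v

data Reach (G : Graph) (S : V G → Set) : V G → V G → Set where
  here : ∀ {u} → S u → Reach G S u u
  step : ∀ {u w v} → S u → Adj G u w → Reach G S w v → Reach G S u v

ConnectedOn : (G : Graph) → (V G → Set) → Set
ConnectedOn G S = ∀ u v → S u → S v → Reach G S u v

-- 2-connected: removing fewer than 2 nodes never leaves a disconnected
-- graph or a single node.
record TwoConnected (G : Graph) : Set where
  field
    conn0   : ConnectedOn G (λ _ → ⊤)
    conn1   : ∀ (x : V G) → ConnectedOn G (λ v → v ≢ x)
    notOne  : n G ≢ 1                     -- removing 0 nodes does not leave a single node
    notTwo  : n G ≢ 2                     -- removing 1 node does not leave a single node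

HasK2Cutset : Graph → Set
HasK2Cutset G = Σ (V G) λ a → Σ (V G) λ b →
  Adj G a b × ¬ ConnectedOn G (λ v → (v ≢ a) × (v ≢ b))

ContainsPropeller : Graph → Set
ContainsPropeller G =
  Σ ℕ λ k → Σ (3 ≤ k) λ p → Σ (InducedSub (Cycle k p) G) λ C →
  Σ (V G) λ x → (∀ i → InducedSub.emb C i ≢ x) ×
  (Σ (Fin k) λ i → Σ (Fin k) λ j → i ≢ j ×
     Adj G x (InducedSub.emb C i) × Adj G x (InducedSub.emb C j))

-- A vertex off the induced cycle C has at most one neighbour on C, or it would be the centre of a
-- propeller. By 2-connectivity every off-cycle vertex lies on a bridge: an off-cycle walk joining
-- neighbours of two distinct vertices a, b of C; for k = 4, 5 the absence of a K₂-cutset lets one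
-- reroute it so that a and b are non-adjacent. A shortest such bridge is an induced path seeing C only
-- at its ends, so it closes up with an arc of C from b to a into a hole, and a common neighbour of a
-- and b on C is the centre of a propeller (on C₄ one of the two common neighbours must miss the bridge,
-- or a shorter bridge would join them). Hence C is all of G.

module Submission where

open import Defs hiding (sym)
open import Data.Bool using (true; false; _∨_)
open import Data.Bool.Properties using (∨-identityʳ) renaming (_≟_ to _≟ᵇ_)
open import Data.Empty using (⊥; ⊥-elim)
open import Data.Fin using (Fin; zero; suc; toℕ; fromℕ<) renaming (_≟_ to _≟ᶠ_)
open import Data.Fin.Properties using (toℕ<n; all?; any?)
open import Data.List using (List; []; _∷_; _++_; [_]; length; lookup; head; last; map)
open import Data.List.Properties using (++-assoc; length-++-≤ʳ)
open import Data.List.Membership.Propositional using (_∈_; _∉_)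
open import Data.List.Membership.Propositional.Properties using (∈-++⁺ʳ; ∈-++⁻; ∈-lookup; ∈-∃++)
open import Data.List.Relation.Unary.All as All using (All; []; _∷_)
open import Data.List.Relation.Unary.All.Properties using (++⁺; ++⁻ʳ)
open import Data.List.Relation.Unary.Any using (here; there)
open import Data.List.Relation.Unary.Linked as Linked using (Linked; [-]; _∷_)
open import Data.List.Relation.Unary.Linked.Properties as Linkedₚ using ()
open import Data.Maybe using (just)
open import Data.Maybe.Relation.Binary.Connected using (Connected)
open import Data.Maybe.Relation.Unary.Any as AnyM using (just) renaming (Any to AnyM)
open import Data.Nat using (ℕ; zero; suc; _+_; _<_; _≤_; _≡ᵇ_; ∣_-_∣; s≤s; z≤n)
open import Data.Nat.Induction using (<-rec)
open import Data.Nat.Properties using (≤-<-trans; <-≤-trans; <⇒≢; ∣m-n∣≤m⊔n; ⊔-lub) renaming (_≟_ to _≟ⁿ_)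
open import Data.Product using (Σ-syntax; ∃; _×_; _,_; proj₁; proj₂)
open import Data.Sum using (_⊎_; inj₁; inj₂)
open import Data.Unit using (⊤; tt)
open import Function.Bundles using (mk⤖)
open import Relation.Binary.PropositionalEquality
  using (_≡_; _≢_; refl; sym; trans; cong; cong₂; subst; ≢-sym)
open import Relation.Nullary using (¬_; Dec; yes; no; ¬?; contradiction)
open import Relation.Nullary.Decidable using (toWitness; dec-false; _×-dec_; _→-dec_)

module _ {A : Set} where

  length-++-monoʳ-< : ∀ (X : List A) {Y Z} → length Y < length Z → length (X ++ Y) < length (X ++ Z)
  length-++-monoʳ-< []      lt = lt
  length-++-monoʳ-< (_ ∷ X) lt = s≤s (length-++-monoʳ-< X lt)

  length-++-monoʳ-≤ : ∀ (X : List A) {Y Z} → length Y ≤ length Z → length (X ++ Y) ≤ length (X ++ Z)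
  length-++-monoʳ-≤ []      le = le
  length-++-monoʳ-≤ (_ ∷ X) le = s≤s (length-++-monoʳ-≤ X le)

  head-++-∷ : ∀ (X : List A) {u} Y Z → head (X ++ u ∷ Y) ≡ head (X ++ u ∷ Z)
  head-++-∷ []      _ _ = refl
  head-++-∷ (_ ∷ _) _ _ = refl

  last-++-∷ : ∀ (X : List A) {u} Y → last (X ++ u ∷ Y) ≡ last (u ∷ Y)
  last-++-∷ []          _ = refl
  last-++-∷ (_ ∷ [])    _ = refl
  last-++-∷ (_ ∷ x ∷ X) Y = last-++-∷ (x ∷ X) Y

  last-++ : ∀ (X : List A) {u} Y → last X ≡ just u → last (X ++ Y) ≡ last (u ∷ Y)
  last-++ (_ ∷ [])    []      refl = refl
  last-++ (_ ∷ [])    (_ ∷ _) refl = refl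
  last-++ (_ ∷ x ∷ X) Y       e    = last-++ (x ∷ X) Y e

  All-prefix : ∀ {P : A → Set} X {u Y} → All P (X ++ u ∷ Y) → All P (X ++ u ∷ [])
  All-prefix []      (pu ∷ _)  = pu ∷ []
  All-prefix (_ ∷ X) (px ∷ ps) = px ∷ All-prefix X ps

≡ᵇ-< : ∀ {m n} → m < n → (m ≡ᵇ n) ≡ false
≡ᵇ-< {m} {n} m<n = dec-false (m ≟ⁿ n) (<⇒≢ m<n)

∣-∣-< : ∀ {L} (i j : Fin L) → ∣ toℕ i - toℕ j ∣ < L
∣-∣-< i j = ≤-<-trans (∣m-n∣≤m⊔n (toℕ i) (toℕ j)) (⊔-lub (toℕ<n i) (toℕ<n j))

3≤3+ : ∀ {m} → 3 ≤ 3 + m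
3≤3+ = s≤s (s≤s (s≤s z≤n))

other : ∀ {k} → 3 ≤ k → (a : Fin k) → ∃ λ j → j ≢ a
other (s≤s (s≤s (s≤s _))) zero    = suc zero , λ ()
other (s≤s (s≤s (s≤s _))) (suc _) = zero , λ ()

twoOthers : ∀ {k} → 3 ≤ k → (a b : Fin k) → ∃ λ j → j ≢ a × j ≢ b
twoOthers (s≤s (s≤s (s≤s _))) zero           zero           = suc zero , (λ ()) , (λ ())
twoOthers (s≤s (s≤s (s≤s _))) zero           (suc zero)     = suc (suc zero) , (λ ()) , (λ ())
twoOthers (s≤s (s≤s (s≤s _))) zero           (suc (suc _))  = suc zero , (λ ()) , (λ ())
twoOthers (s≤s (s≤s (s≤s _))) (suc zero)     zero           = suc (suc zero) , (λ ()) , (λ ())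
twoOthers (s≤s (s≤s (s≤s _))) (suc zero)     (suc _)        = zero , (λ ()) , (λ ())
twoOthers (s≤s (s≤s (s≤s _))) (suc (suc _))  zero           = suc zero , (λ ()) , (λ ())
twoOthers (s≤s (s≤s (s≤s _))) (suc (suc _))  (suc _)        = zero , (λ ()) , (λ ())

TriangleFree : Graph → Set
TriangleFree H = ∀ a b c → Adj H a b → Adj H b c → Adj H a c → ⊥

surjective-inducedSub⇒Iso : ∀ {H G} (C : InducedSub H G) →
  (∀ v → ∃ λ i → InducedSub.emb C i ≡ v) → Iso G H
surjective-inducedSub⇒Iso {H} {G} C onto = record { bij = mk⤖ {to = to} (to-injective , to-surjective) ; adjPres = to-adj }
  where
  open InducedSub C
  to : V G → V H
  to v = proj₁ (onto v)
  emb-to : ∀ v → emb (to v) ≡ v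
  emb-to v = proj₂ (onto v)
  to-injective : ∀ {u v} → to u ≡ to v → u ≡ v
  to-injective {u} {v} e = trans (sym (emb-to u)) (trans (cong emb e) (emb-to v))
  to-surjective : ∀ i → ∃ λ v → ∀ {u} → u ≡ v → to u ≡ i
  to-surjective i = emb i , λ { refl → inj (emb-to (emb i)) }
  to-adj : ∀ u v → E H (to u) (to v) ≡ E G u v
  to-adj u v = sym (trans (cong₂ (E G) (sym (emb-to u)) (sym (emb-to v))) (adjPres (to u) (to v)))

module Paths (G : Graph) where

  infix 4 _∼_ _≁_
  _∼_ _≁_ : V G → V G → Set
  u ∼ v = Adj G u v
  u ≁ v = E G u v ≡ false

  ∼-sym : ∀ {u v} → u ∼ v → v ∼ u
  ∼-sym {u} {v} = trans (Graph.sym G v u)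

  ≁-sym : ∀ {u v} → u ≁ v → v ≁ u
  ≁-sym {u} {v} = trans (Graph.sym G v u)

  ¬∼⇒≁ : ∀ {u v} → ¬ u ∼ v → u ≁ v
  ¬∼⇒≁ {u} {v} ¬u∼v with E G u v
  ... | false = refl
  ... | true  = contradiction refl ¬u∼v

  adjacent? : ∀ u v → u ≁ v ⊎ u ∼ v
  adjacent? u v with E G u v
  ... | false = inj₁ refl
  ... | true  = inj₂ refl

  neighbourIn? : ∀ c Q → All (c ≁_) Q ⊎ Σ[ w ∈ V G ] w ∈ Q × w ∼ c
  neighbourIn? c []      = inj₁ []
  neighbourIn? c (w ∷ Q) with adjacent? w c | neighbourIn? c Q
  ... | inj₂ w∼c | _                  = inj₂ (w , here refl , w∼c)
  ... | inj₁ w≁c | inj₁ c≁Q           = inj₁ (≁-sym w≁c ∷ c≁Q)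
  ... | inj₁ _   | inj₂ (v , m , v∼c) = inj₂ (v , there m , v∼c)

  Walk : List (V G) → Set
  Walk = Linked _∼_

  walk-suffix : ∀ X {Y} → Walk (X ++ Y) → Walk Y
  walk-suffix []      w = w
  walk-suffix (_ ∷ X) w = walk-suffix X (Linked.tail w)

  walk-prefix : ∀ X {u Y} → Walk (X ++ u ∷ Y) → Walk (X ++ u ∷ [])
  walk-prefix []          _       = [-]
  walk-prefix (_ ∷ [])    (a ∷ _) = a ∷ [-]
  walk-prefix (_ ∷ x ∷ X) (a ∷ w) = a ∷ walk-prefix (x ∷ X) w

  walk-++ : ∀ {X u Y} → Walk X → last X ≡ just u → Walk (u ∷ Y) → Walk (X ++ Y)
  walk-++ {Y = Y} w e w′ =
    Linkedₚ.++⁺ w (subst (λ m → Connected _∼_ m (head Y)) (sym e) (Linked.head′ w′)) (Linked.tail w′)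

  AdjacentToHead : V G → List (V G) → Set
  AdjacentToHead u []      = ⊤
  AdjacentToHead u (v ∷ _) = u ∼ v

  NonAdjacentPastHead : V G → List (V G) → Set
  NonAdjacentPastHead u []      = ⊤
  NonAdjacentPastHead u (_ ∷ s) = All (u ≁_) s

  InducedPath : List (V G) → Set
  InducedPath []      = ⊤
  InducedPath (u ∷ s) = u ∉ s × AdjacentToHead u s × NonAdjacentPastHead u s × InducedPath s

  AdjacentOnlyToLast : V G → List (V G) → Set
  AdjacentOnlyToLast c []          = ⊥
  AdjacentOnlyToLast c (u ∷ [])    = u ∼ c
  AdjacentOnlyToLast c (u ∷ w ∷ s) = u ≁ c × AdjacentOnlyToLast c (w ∷ s)

  headRow : ∀ u s → AdjacentToHead u s → NonAdjacentPastHead u s →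
            ∀ j → E G u (lookup s j) ≡ (toℕ j ≡ᵇ 0)
  headRow u (_ ∷ _) u∼v _   zero    = u∼v
  headRow u (_ ∷ s) _   u≁s (suc j) = All.lookup u≁s (∈-lookup j)

  inducedPath-E : ∀ r → InducedPath r → ∀ i j → E G (lookup r i) (lookup r j) ≡ (∣ toℕ i - toℕ j ∣ ≡ᵇ 1)
  inducedPath-E (u ∷ s) _               zero    zero    = Graph.irref G u
  inducedPath-E (u ∷ s) (_ , h , t , _) zero    (suc j) = headRow u s h t j
  inducedPath-E (u ∷ s) (_ , h , t , _) (suc i) zero    = trans (Graph.sym G _ u) (headRow u s h t i)
  inducedPath-E (u ∷ s) (_ , _ , _ , p) (suc i) (suc j) = inducedPath-E s p i j

  lookup-∷-injective : ∀ {u : V G} {s} → u ∉ s → (∀ {i j} → lookup s i ≡ lookup s j → i ≡ j) →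
                       ∀ {i j} → lookup (u ∷ s) i ≡ lookup (u ∷ s) j → i ≡ j
  lookup-∷-injective u∉s inj {zero}  {zero}  _ = refl
  lookup-∷-injective u∉s inj {zero}  {suc j} e = contradiction (subst (_∈ _) (sym e) (∈-lookup j)) u∉s
  lookup-∷-injective u∉s inj {suc i} {zero}  e = contradiction (subst (_∈ _) e (∈-lookup i)) u∉s
  lookup-∷-injective u∉s inj {suc i} {suc j} e = cong suc (inj e)

  inducedPath-lookup-injective : ∀ r → InducedPath r → ∀ {i j} → lookup r i ≡ lookup r j → i ≡ j
  inducedPath-lookup-injective (u ∷ s) (u∉s , _ , _ , p) =
    lookup-∷-injective u∉s (inducedPath-lookup-injective s p)

  lastColumn : ∀ c s → AdjacentOnlyToLast c s → ∀ j → E G (lookup s j) c ≡ (suc (toℕ j) ≡ᵇ length s)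
  lastColumn c (_ ∷ [])    u∼c      zero    = u∼c
  lastColumn c (_ ∷ _ ∷ _) (u≁c , _) zero    = u≁c
  lastColumn c (_ ∷ w ∷ s) (_ , o)   (suc j) = lastColumn c (w ∷ s) o j

  closingRow : ∀ c r₁ s → c ∼ r₁ → AdjacentOnlyToLast c s →
               ∀ j → E G c (lookup (r₁ ∷ s) j) ≡ (toℕ j ≡ᵇ 0) ∨ (suc (toℕ j) ≡ᵇ suc (length s))
  closingRow c r₁ s c∼r₁ _ zero    = c∼r₁
  closingRow c r₁ s _    o (suc j) = trans (Graph.sym G c _) (lastColumn c s o j)

  closeInducedPath : ∀ c r₁ r₂ rs → InducedPath (r₁ ∷ r₂ ∷ rs) → c ∉ r₁ ∷ r₂ ∷ rs →
                     c ∼ r₁ → AdjacentOnlyToLast c (r₂ ∷ rs) → InducedSub (Cycle (3 + length rs) 3≤3+) G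
  closeInducedPath c r₁ r₂ rs path c∉r c∼r₁ only = record
    { emb     = lookup (c ∷ r)
    ; inj     = lookup-∷-injective c∉r (inducedPath-lookup-injective r path)
    ; adjPres = adj
    }
    where
    r = r₁ ∷ r₂ ∷ rs
    adj : ∀ i j → E G (lookup (c ∷ r) i) (lookup (c ∷ r) j) ≡ cycleE (3 + length rs) i j
    adj zero    zero    = Graph.irref G c
    adj zero    (suc j) = closingRow c r₁ (r₂ ∷ rs) c∼r₁ only j
    adj (suc i) zero    = trans (Graph.sym G _ c) (closingRow c r₁ (r₂ ∷ rs) c∼r₁ only i)
    adj (suc i) (suc j) = trans (inducedPath-E r path i j)
      (sym (trans (cong ((∣ toℕ i - toℕ j ∣ ≡ᵇ 1) ∨_) (≡ᵇ-< (∣-∣-< i j))) (∨-identityʳ _)))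

  propeller : ∀ c r₁ r₂ rs → InducedPath (r₁ ∷ r₂ ∷ rs) → c ∉ r₁ ∷ r₂ ∷ rs →
              c ∼ r₁ → AdjacentOnlyToLast c (r₂ ∷ rs) →
              ∀ z → z ∉ c ∷ r₁ ∷ r₂ ∷ rs → z ∼ c → ∀ j → z ∼ lookup (r₁ ∷ r₂ ∷ rs) j → ContainsPropeller G
  propeller c r₁ r₂ rs path c∉r c∼r₁ only z z∉ z∼c j z∼j =
    _ , 3≤3+ , closeInducedPath c r₁ r₂ rs path c∉r c∼r₁ only , z ,
    (λ i e → z∉ (subst (_∈ _) e (∈-lookup i))) , zero , suc j , (λ ()) , z∼c , z∼j

  module _ (S : V G → Set) where

    Shortest : List (V G) → Set
    Shortest P = ∀ Q → Walk Q → All S Q → length Q < length P → head Q ≡ head P → last Q ≡ last P → ⊥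

    shortest-tail : ∀ {u w s} → Walk (u ∷ w ∷ s) → S u → Shortest (u ∷ w ∷ s) → Shortest (w ∷ s)
    shortest-tail (u∼w ∷ _) su sh (_ ∷ Q) wQ sQ lt refl lQ = sh (_ ∷ _ ∷ Q) (u∼w ∷ wQ) (su ∷ sQ) (s≤s lt) refl lQ

    shortest⇒no-repeat : ∀ {u rest} X {v} Y → rest ≡ X ++ v ∷ Y →
                         Walk (u ∷ rest) → All S (u ∷ rest) → Shortest (u ∷ rest) → u ≢ v
    shortest⇒no-repeat {u} X Y refl w (su ∷ ss) sh refl =
      sh (u ∷ Y) (walk-suffix (u ∷ X) w) (++⁻ʳ X ss) (s≤s (length-++-≤ʳ (u ∷ Y) {X})) refl
         (sym (last-++-∷ (u ∷ X) Y))

    shortest⇒no-chord : ∀ {u rest} X {v} Y → rest ≡ X ++ v ∷ Y →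
                        Walk (u ∷ rest) → All S (u ∷ rest) → Shortest (u ∷ rest) → u ∼ v → X ≡ []
    shortest⇒no-chord         []      Y refl _ _         _  _   = refl
    shortest⇒no-chord {u} (x ∷ X) {v} Y refl w (su ∷ ss) sh u∼v = ⊥-elim
      (sh (u ∷ v ∷ Y) (u∼v ∷ walk-suffix (u ∷ x ∷ X) w) (su ∷ ++⁻ʳ (x ∷ X) ss)
          (s≤s (s≤s (length-++-≤ʳ (v ∷ Y) {X}))) refl (sym (last-++-∷ (u ∷ x ∷ X) Y)))

    shortest⇒inducedPath : ∀ P → Walk P → All S P → Shortest P → InducedPath P
    shortest⇒inducedPath []          _            _         _  = tt
    shortest⇒inducedPath (_ ∷ [])    _            _         _  = (λ ()) , tt , tt , tt
    shortest⇒inducedPath (u ∷ w ∷ s) wk@(u∼w ∷ w′) ss@(su ∷ ss′) sh =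
      u∉ , u∼w , All.tabulate u≁ , shortest⇒inducedPath (w ∷ s) w′ ss′ (shortest-tail wk su sh)
      where
      u∉ : u ∉ w ∷ s
      u∉ m with X , Y , e ← ∈-∃++ m = shortest⇒no-repeat X Y e wk ss sh refl
      u≁ : ∀ {v} → v ∈ s → u ≁ v
      u≁ m with X , Y , e ← ∈-∃++ m =
        ¬∼⇒≁ (λ u∼v → contradiction (shortest⇒no-chord (w ∷ X) Y (cong (w ∷_) e) wk ss sh u∼v) λ ())

OffCycle : ∀ {H G} → InducedSub H G → V G → Set
OffCycle C u = ∀ i → InducedSub.emb C i ≢ u

reach-start : ∀ {G S u v} → Reach G S u v → S u
reach-start (here su)     = su
reach-start (step su _ _) = su

module AroundCycle {G : Graph} {k : ℕ} {p : 3 ≤ k} (C : InducedSub (Cycle k p) G)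
                   (noPropeller : ¬ ContainsPropeller G) where

  open Paths G
  open InducedSub C public using (emb)
  open InducedSub C using (adjPres)

  emb-≢ : ∀ {i j} → i ≢ j → emb i ≢ emb j
  emb-≢ i≢j e = i≢j (InducedSub.inj C e)

  fromCycle : ∀ {i j b} → cycleE k i j ≡ b → E G (emb i) (emb j) ≡ b
  fromCycle {i} {j} = trans (adjPres i j)

  toCycle : ∀ {i j b} → E G (emb i) (emb j) ≡ b → cycleE k i j ≡ b
  toCycle {i} {j} = trans (sym (adjPres i j))

  emb-∉ : ∀ {z} is {P} → All (z ≢_) is → All (OffCycle C) P → emb z ∉ map emb is ++ P
  emb-∉ {z} []       []           off m        = All.lookup off m z refl
  emb-∉     (_ ∷ _)  (z≢i ∷ _)    _   (here e)  = emb-≢ z≢i e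
  emb-∉     (_ ∷ is) (_ ∷ z≢is)   off (there m) = emb-∉ is z≢is off m

  atMostOneNeighbour : ∀ {u i j} → OffCycle C u → u ∼ emb i → u ∼ emb j → i ≡ j
  atMostOneNeighbour {u} {i} {j} off u∼i u∼j with i ≟ᶠ j
  ... | yes i≡j = i≡j
  ... | no  i≢j = ⊥-elim (noPropeller (k , p , C , u , off , i , j , i≢j , u∼i , u∼j))

  record Bridge (a b : Fin k) (P : List (V G)) : Set where
    constructor bridge
    field
      walk     : Walk P
      offCycle : All (OffCycle C) P
      start    : AnyM (_∼ emb a) (head P)
      end      : AnyM (_∼ emb b) (last P)

  lastVertex : ∀ {c} W → All (OffCycle C) W → AnyM (_∼ emb c) (last W) →
               Σ[ u ∈ V G ] last W ≡ just u × OffCycle C u × u ∼ emb c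
  lastVertex (u ∷ [])    (off ∷ []) (just u∼c) = u , refl , off , u∼c
  lastVertex (_ ∷ w ∷ s) (_ ∷ offs) e          = lastVertex (w ∷ s) offs e

  bridge-++ : ∀ {a b c P u W} → Bridge a b P → last P ≡ just u → Bridge b c (u ∷ W) → Bridge a c (P ++ W)
  bridge-++ {P = x ∷ P} {u} {W} (bridge w o s _) e (bridge w′ o′ _ end′) =
    bridge (walk-++ w e w′) (++⁺ o (All.tail o′)) s (subst (AnyM _) (sym (last-++ (x ∷ P) W e)) end′)

  record Approach (S : V G → Set) (u : V G) : Set where
    constructor approach
    field
      {target} : Fin k
      inS      : S (emb target)
      {rest}   : List (V G)
      walk     : Walk (u ∷ rest)
      offCycle : All (OffCycle C) (u ∷ rest)
      end      : AnyM (_∼ emb target) (last (u ∷ rest))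

  approach-cycle : ∀ {S u t} → Reach G S u t → OffCycle C u → (∃ λ i → emb i ≡ t) → Approach S u
  approach-cycle (here _) off (i , e) = ⊥-elim (off i e)
  approach-cycle (step {w = w} _ u∼w rest) off onCycle with any? (λ i → emb i ≟ᶠ w)
  ... | yes (_ , refl) = approach (reach-start rest) [-] (off ∷ []) (just u∼w)
  ... | no  off-w with approach-cycle rest (λ i e → off-w (i , e)) onCycle
  ...   | approach s w o e = approach s (u∼w ∷ w) (off ∷ o) e

  toBridge : ∀ {S u a} (ap : Approach S u) → u ∼ emb a → Bridge a (Approach.target ap) (u ∷ Approach.rest ap)
  toBridge (approach _ w o e) u∼a = bridge w o (just u∼a) e

  a₀ : Fin k
  a₀ = fromℕ< (<-≤-trans (s≤s z≤n) p)

  distinctBridge : TwoConnected G → ∀ {v} → OffCycle C v →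
                   Σ[ a ∈ Fin k ] Σ[ b ∈ Fin k ] Σ[ P ∈ List (V G) ] a ≢ b × Bridge a b P
  distinctBridge tc {v} off-v
    with approach {a} _ _ o e ← approach-cycle (TwoConnected.conn0 tc v (emb a₀) tt tt) off-v (a₀ , refl)
    with u , _ , off-u , u∼a ← lastVertex _ o e
    with j , j≢a ← other p a
    with ap ← approach-cycle (TwoConnected.conn1 tc (emb a) u (emb j) (λ e → off-u a (sym e)) (emb-≢ j≢a)) off-u (j , refl)
    = a , Approach.target ap , _ , (λ e → Approach.inS ap (cong emb (sym e))) , toBridge ap u∼a

  module Bridges (Admissible : Fin k → Fin k → Set) where

    HasAdmissibleBridge : Set
    HasAdmissibleBridge = Σ[ a ∈ Fin k ] Σ[ b ∈ Fin k ] Σ[ P ∈ List (V G) ] Admissible a b × Bridge a b P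

    Minimal : List (V G) → Set
    Minimal P = ∀ {a b Q} → length Q < length P → Admissible a b → Bridge a b Q → ⊥

    ExcludesMinimal : Set
    ExcludesMinimal = ∀ {a b h T} → Admissible a b → Bridge a b (h ∷ T) → Minimal (h ∷ T) → ⊥

    noAdmissibleBridge : ExcludesMinimal → ¬ HasAdmissibleBridge
    noAdmissibleBridge excl (_ , _ , P , ad , br) = <-rec NoBridgeOfLength shorter⇒this (length P) refl ad br
      where
      NoBridgeOfLength : ℕ → Set
      NoBridgeOfLength n = ∀ {a b Q} → length Q ≡ n → Admissible a b → Bridge a b Q → ⊥
      shorter⇒this : ∀ n → (∀ {m} → m < n → NoBridgeOfLength m) → NoBridgeOfLength n
      shorter⇒this _ _  {Q = []}    _    _  (bridge _ _ () _)
      shorter⇒this _ ih {Q = _ ∷ _} refl ad br = excl ad br (λ lt → ih lt refl)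

    module MinimalBridge {a b P} (ad : Admissible a b) (br : Bridge a b P) (min : Minimal P) where
      open Bridge br

      inducedPath : InducedPath P
      inducedPath = shortest⇒inducedPath (OffCycle C) P walk offCycle λ Q w o lt hQ lQ →
        min lt ad (bridge w o (subst (AnyM _) (sym hQ) start) (subst (AnyM _) (sym lQ) end))

      first-adjacent : ∀ {w B} → P ≡ w ∷ B → w ∼ emb a
      first-adjacent refl = AnyM.drop-just start

      last-adjacent : ∀ A {w} → P ≡ A ++ w ∷ [] → w ∼ emb b
      last-adjacent A refl = AnyM.drop-just (subst (AnyM _) (last-++-∷ A []) end)

      neighbour⇒last : ∀ A {w} B {t} → P ≡ A ++ w ∷ B → w ∼ emb t → Admissible a t → B ≡ []
      neighbour⇒last A []      _    _   _   = refl
      neighbour⇒last A (_ ∷ _) refl w∼t ad′ = ⊥-elim (min (length-++-monoʳ-< A (s≤s (s≤s z≤n))) ad′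
        (bridge (walk-prefix A walk) (All-prefix A offCycle) (subst (AnyM _) (head-++-∷ A _ _) start)
                (subst (AnyM _) (sym (last-++-∷ A [])) (just w∼t))))

      neighbour⇒first : ∀ A {w} B {t} → P ≡ A ++ w ∷ B → w ∼ emb t → Admissible t b → A ≡ []
      neighbour⇒first []      _ _    _   _   = refl
      neighbour⇒first (x ∷ A) B refl w∼t ad′ = ⊥-elim (min (s≤s (length-++-≤ʳ (_ ∷ B) {A})) ad′
        (bridge (walk-suffix (x ∷ A) walk) (++⁻ʳ (x ∷ A) offCycle) (just w∼t)
                (subst (AnyM _) (last-++-∷ (x ∷ A) B) end)))

      startPath : InducedPath (emb a ∷ P)
      startPath = emb-∉ [] [] offCycle , startEdge P refl , startNonEdges P refl , inducedPath
        where
        startEdge : ∀ Q → P ≡ Q → AdjacentToHead (emb a) Q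
        startEdge []      _ = tt
        startEdge (_ ∷ _) e = ∼-sym (first-adjacent e)
        startNonEdges : ∀ Q → P ≡ Q → NonAdjacentPastHead (emb a) Q
        startNonEdges []      _ = tt
        startNonEdges (h ∷ T) e = All.tabulate λ m → ¬∼⇒≁ λ a∼w →
          let X , Y , e′ = ∈-∃++ m
          in contradiction (neighbour⇒first (h ∷ X) Y (trans e (cong (h ∷_) e′)) (∼-sym a∼w) ad) λ ()

      endOnlyLast : AdjacentOnlyToLast (emb b) P
      endOnlyLast = onlyLast [] P refl end
        where
        onlyLast : ∀ X Q → P ≡ X ++ Q → AnyM (_∼ emb b) (last Q) → AdjacentOnlyToLast (emb b) Q
        onlyLast X (_ ∷ [])    _ (just u∼b) = u∼b
        onlyLast X (u ∷ w ∷ s) e l          =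
          ¬∼⇒≁ (λ u∼b → contradiction (neighbour⇒last X (w ∷ s) e u∼b ad) λ ()) ,
          onlyLast (X ++ [ u ]) (w ∷ s) (trans e (sym (++-assoc X [ u ] (w ∷ s)))) l

      noNeighbours : ∀ t → t ≢ a → t ≢ b → Admissible a t ⊎ Admissible t b → All (emb t ≁_) P
      noNeighbours t t≢a t≢b adm = All.tabulate λ m → ≁-sym (¬∼⇒≁ (λ w∼t → neighbour⇒⊥ m w∼t adm))
        where
        neighbour⇒⊥ : ∀ {w} → w ∈ P → w ∼ emb t → Admissible a t ⊎ Admissible t b → ⊥
        neighbour⇒⊥ m w∼t (inj₁ ad′) with X , Y , e ← ∈-∃++ m | neighbour⇒last X Y e w∼t ad′
        ... | refl = t≢b (atMostOneNeighbour (All.lookup offCycle m) w∼t (last-adjacent X e))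
        neighbour⇒⊥ m w∼t (inj₂ ad′) with X , Y , e ← ∈-∃++ m | neighbour⇒first X Y e w∼t ad′
        ... | refl = t≢a (atMostOneNeighbour (All.lookup offCycle m) w∼t (first-adjacent e))

      -- The part of P from w to w′ would be a shorter admissible bridge from t to t′.
      segment⇒⊥ : ∀ X {w} Y {w′ t t′} → P ≡ X ++ w ∷ Y → w′ ∈ Y → w ∼ emb t → w′ ∼ emb t′ →
                  t ≢ a → Admissible t t′ → ⊥
      segment⇒⊥ []      _ e    _  w∼t _    t≢a _   =
        t≢a (atMostOneNeighbour (All.lookup offCycle (subst (_ ∈_) (sym e) (here refl))) w∼t (first-adjacent e))
      segment⇒⊥ (x ∷ X) {w} Y refl m w∼t w′∼t′ _ ad′ with Y₁ , Y₂ , refl ← ∈-∃++ m =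
        min (≤-<-trans (length-++-monoʳ-≤ (w ∷ Y₁) (s≤s z≤n)) (s≤s (length-++-≤ʳ (w ∷ Y₁ ++ _ ∷ Y₂) {X}))) ad′
          (bridge (walk-prefix (w ∷ Y₁) (walk-suffix (x ∷ X) walk))
                  (All-prefix (w ∷ Y₁) (++⁻ʳ (x ∷ X) offCycle))
                  (just w∼t) (subst (AnyM _) (sym (last-++-∷ (w ∷ Y₁) [])) (just w′∼t′)))

      twoNeighbours⇒⊥ : ∀ {w w′ t t′} → w ∈ P → w′ ∈ P → w ∼ emb t → w′ ∼ emb t′ →
                        t ≢ t′ → t ≢ a → t′ ≢ a → Admissible t t′ → Admissible t′ t → ⊥
      twoNeighbours⇒⊥ {w} {w′} m m′ w∼t w′∼t′ t≢t′ t≢a t′≢a ad₁ ad₂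
        with X , Y , e ← ∈-∃++ m
        with ∈-++⁻ X (subst (w′ ∈_) e m′)
      ... | inj₂ (here refl)  = t≢t′ (atMostOneNeighbour (All.lookup offCycle m) w∼t w′∼t′)
      ... | inj₂ (there m′Y) = segment⇒⊥ X Y e m′Y w∼t w′∼t′ t≢a ad₁
      ... | inj₁ m′X with X₁ , X₂ , refl ← ∈-∃++ m′X =
        segment⇒⊥ X₁ (X₂ ++ w ∷ Y) (trans e (++-assoc X₁ (w′ ∷ X₂) (w ∷ Y))) (∈-++⁺ʳ X₂ (here refl))
                  w′∼t′ w∼t t′≢a ad₂

  Nonadjacent : Fin k → Fin k → Set
  Nonadjacent a b = a ≢ b × emb a ≁ emb b

  -- If the ends of a bridge are adjacent, they form a K₂ whose removal leaves G connected; a walk in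
  -- G − {emb a, emb b} from the last vertex of the bridge to a third cycle vertex c then yields a bridge
  -- from a or b to c, and c cannot be adjacent to both since C has no triangle.
  nonadjacentBridge : TwoConnected G → ¬ HasK2Cutset G → TriangleFree (Cycle k p) →
                      ∀ {v} → OffCycle C v → ¬ ¬ Bridges.HasAdmissibleBridge Nonadjacent
  nonadjacentBridge tc noCut noTriangle off-v noBridge with distinctBridge tc off-v
  ... | a , b , P , a≢b , br with adjacent? (emb a) (emb b)
  ...   | inj₁ a≁b = noBridge (a , b , P , (a≢b , a≁b) , br)
  ...   | inj₂ a∼b = noCut (emb a , emb b , a∼b , λ conn → noBridge (viaThird conn))
    where
    viaThird : ConnectedOn G (λ v → v ≢ emb a × v ≢ emb b) → Bridges.HasAdmissibleBridge Nonadjacent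
    viaThird conn
      with u , lastP , off-u , u∼b ← lastVertex P (Bridge.offCycle br) (Bridge.end br)
      with j , j≢a , j≢b ← twoOthers p a b
      with approach {c} (c≢a , c≢b) w o e ←
             approach-cycle (conn u (emb j) ((λ e → off-u a (sym e)) , (λ e → off-u b (sym e)))
                                            (emb-≢ j≢a , emb-≢ j≢b)) off-u (j , refl)
      with adjacent? (emb b) (emb c) | adjacent? (emb a) (emb c)
    ... | inj₁ b≁c | _        = b , c , _ , ((λ e → c≢b (cong emb (sym e))) , b≁c) , bridge w o (just u∼b) e
    ... | inj₂ b∼c | inj₁ a≁c = a , c , _ , ((λ e → c≢a (cong emb (sym e))) , a≁c) ,
                                bridge-++ br lastP (bridge w o (just u∼b) e)
    ... | inj₂ b∼c | inj₂ a∼c = ⊥-elim (noTriangle a b c (toCycle a∼b) (toCycle b∼c) (toCycle a∼c))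

CommonNeighbour : ∀ k → Fin k → Fin k → Fin k → Set
CommonNeighbour k a b t = t ≢ a × t ≢ b × cycleE k t a ≡ true × cycleE k t b ≡ true

commonNeighbour? : ∀ k a b t → Dec (CommonNeighbour k a b t)
commonNeighbour? k a b t =
  ¬? (t ≟ᶠ a) ×-dec ¬? (t ≟ᶠ b) ×-dec (cycleE k t a ≟ᵇ true) ×-dec (cycleE k t b ≟ᵇ true)

abstract

  C3-distinct : ∀ a b → a ≢ b → cycleE 3 b a ≡ true × ∃ (CommonNeighbour 3 a b)
  C3-distinct = toWitness {a? = all? λ a → all? λ b → ¬? (a ≟ᶠ b) →-dec
    ((cycleE 3 b a ≟ᵇ true) ×-dec any? (commonNeighbour? 3 a b))} tt

  C4-opposite : ∀ a b → a ≢ b → cycleE 4 a b ≡ false →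
                Σ[ t ∈ Fin 4 ] Σ[ s ∈ Fin 4 ] t ≢ s × cycleE 4 t s ≡ false ×
                  CommonNeighbour 4 a b t × CommonNeighbour 4 a b s
  C4-opposite = toWitness {a? = all? λ a → all? λ b → ¬? (a ≟ᶠ b) →-dec ((cycleE 4 a b ≟ᵇ false) →-dec
    any? λ t → any? λ s → ¬? (t ≟ᶠ s) ×-dec (cycleE 4 t s ≟ᵇ false) ×-dec
      commonNeighbour? 4 a b t ×-dec commonNeighbour? 4 a b s)} tt

  -- z is the common neighbour of a and b on C₅, and b x y a is the other arc between them.
  C5-nonadjacent : ∀ a b → a ≢ b → cycleE 5 a b ≡ false →
                   Σ[ z ∈ Fin 5 ] Σ[ x ∈ Fin 5 ] Σ[ y ∈ Fin 5 ] CommonNeighbour 5 a b z × z ≢ x × z ≢ y ×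
                     x ≢ a × x ≢ b × y ≢ a × y ≢ b × x ≢ y ×
                     cycleE 5 b x ≡ true × cycleE 5 x y ≡ true × cycleE 5 y a ≡ true ×
                     cycleE 5 x a ≡ false × cycleE 5 y b ≡ false
  C5-nonadjacent = toWitness {a? = all? λ a → all? λ b → ¬? (a ≟ᶠ b) →-dec ((cycleE 5 a b ≟ᵇ false) →-dec
    any? λ z → any? λ x → any? λ y → commonNeighbour? 5 a b z ×-dec ¬? (z ≟ᶠ x) ×-dec ¬? (z ≟ᶠ y) ×-dec
      ¬? (x ≟ᶠ a) ×-dec ¬? (x ≟ᶠ b) ×-dec ¬? (y ≟ᶠ a) ×-dec ¬? (y ≟ᶠ b) ×-dec ¬? (x ≟ᶠ y) ×-dec
      (cycleE 5 b x ≟ᵇ true) ×-dec (cycleE 5 x y ≟ᵇ true) ×-dec (cycleE 5 y a ≟ᵇ true) ×-dec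
      (cycleE 5 x a ≟ᵇ false) ×-dec (cycleE 5 y b ≟ᵇ false))} tt

  C4-triangleFree : TriangleFree (Cycle 4 3≤3+)
  C4-triangleFree = toWitness {a? = all? λ a → all? λ b → all? λ c →
    (cycleE 4 a b ≟ᵇ true) →-dec ((cycleE 4 b c ≟ᵇ true) →-dec ((cycleE 4 a c ≟ᵇ true) →-dec no λ ()))} tt

  C5-triangleFree : TriangleFree (Cycle 5 3≤3+)
  C5-triangleFree = toWitness {a? = all? λ a → all? λ b → all? λ c →
    (cycleE 5 a b ≟ᵇ true) →-dec ((cycleE 5 b c ≟ᵇ true) →-dec ((cycleE 5 a c ≟ᵇ true) →-dec no λ ()))} tt

module Length3 {G : Graph} (C : InducedSub (Cycle 3 3≤3+) G) (noPropeller : ¬ ContainsPropeller G) where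
  open Paths G
  open AroundCycle {p = 3≤3+} C noPropeller
  open Bridges _≢_

  -- The bridge closes up with the edge b a into a hole, and the third vertex of C₃ sees both a and b.
  excludesMinimal : ExcludesMinimal
  excludesMinimal {a} {b} {h} {T} a≢b br min =
    let b∼a , z , z≢a , z≢b , z∼a , z∼b = C3-distinct a b a≢b
    in noPropeller (propeller (emb b) (emb a) h T startPath (emb-∉ (a ∷ []) (≢-sym a≢b ∷ []) offCycle)
                              (fromCycle b∼a) endOnlyLast
                              (emb z) (emb-∉ (b ∷ a ∷ []) (z≢b ∷ z≢a ∷ []) offCycle) (fromCycle z∼b) zero (fromCycle z∼a))
    where
    open MinimalBridge a≢b br min
    open Bridge br

  noOffCycleVertex : TwoConnected G → ∀ v → ¬ OffCycle C v
  noOffCycleVertex tc v off = noAdmissibleBridge excludesMinimal (distinctBridge tc off)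

module Length4 {G : Graph} (C : InducedSub (Cycle 4 3≤3+) G) (noPropeller : ¬ ContainsPropeller G) where
  open Paths G
  open AroundCycle {p = 3≤3+} C noPropeller
  open Bridges Nonadjacent

  module _ {a b h T} (ad : Nonadjacent a b) (br : Bridge a b (h ∷ T)) (min : Minimal (h ∷ T)) where
    open MinimalBridge ad br min
    open Bridge br

    -- If t has no neighbour on the bridge, b t a + bridge is a hole and s sees both a and b.
    hole : ∀ {t s} → CommonNeighbour 4 a b t → CommonNeighbour 4 a b s → s ≢ t →
           All (emb t ≁_) (h ∷ T) → ContainsPropeller G
    hole {t} {s} (t≢a , t≢b , t∼a , t∼b) (s≢a , s≢b , s∼a , s∼b) s≢t t-free =
      propeller (emb b) (emb t) (emb a) (h ∷ T)
        (emb-∉ (a ∷ []) (t≢a ∷ []) offCycle , fromCycle t∼a , t-free , startPath)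
        (emb-∉ (t ∷ a ∷ []) (≢-sym t≢b ∷ ≢-sym (proj₁ ad) ∷ []) offCycle)
        (∼-sym (fromCycle t∼b)) (proj₂ ad , endOnlyLast)
        (emb s) (emb-∉ (b ∷ t ∷ a ∷ []) (s≢b ∷ s≢t ∷ s≢a ∷ []) offCycle) (fromCycle s∼b) (suc zero) (fromCycle s∼a)

    -- Otherwise both t and s have neighbours on the bridge, which minimality forbids.
    excludesMinimal : ⊥
    excludesMinimal with t , s , t≢s , t≁s , t-common , s-common ← C4-opposite a b (proj₁ ad) (toCycle (proj₂ ad))
      with neighbourIn? (emb t) (h ∷ T) | neighbourIn? (emb s) (h ∷ T)
    ... | inj₁ t-free | _            = noPropeller (hole t-common s-common (≢-sym t≢s) t-free)
    ... | inj₂ _      | inj₁ s-free  = noPropeller (hole s-common t-common t≢s s-free)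
    ... | inj₂ (_ , m , w∼t) | inj₂ (_ , m′ , w′∼s) =
      twoNeighbours⇒⊥ m m′ w∼t w′∼s t≢s (proj₁ t-common) (proj₁ s-common)
        (t≢s , fromCycle t≁s) (≢-sym t≢s , ≁-sym (fromCycle t≁s))

  noOffCycleVertex : TwoConnected G → ¬ HasK2Cutset G → ∀ v → ¬ OffCycle C v
  noOffCycleVertex tc noCut v off =
    nonadjacentBridge tc noCut C4-triangleFree off (noAdmissibleBridge excludesMinimal)

module Length5 {G : Graph} (C : InducedSub (Cycle 5 3≤3+) G) (noPropeller : ¬ ContainsPropeller G) where
  open Paths G
  open AroundCycle {p = 3≤3+} C noPropeller
  open Bridges Nonadjacent

  -- The bridge closes up with the arc b x y a into a hole: minimality keeps x and y off the bridge.
  -- The common neighbour of a and b is then the centre of a propeller.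
  excludesMinimal : ExcludesMinimal
  excludesMinimal {a} {b} {h} {T} ad@(a≢b , a≁b) br min =
    let z , x , y , (z≢a , z≢b , z∼a , z∼b) , z≢x , z≢y , x≢a , x≢b , y≢a , y≢b , x≢y ,
          b∼x , x∼y , y∼a , x≁a , y≁b = C5-nonadjacent a b a≢b (toCycle a≁b)
    in noPropeller (propeller (emb b) (emb x) (emb y) (emb a ∷ h ∷ T)
         (emb-∉ (y ∷ a ∷ []) (x≢y ∷ x≢a ∷ []) offCycle , fromCycle x∼y ,
          fromCycle x≁a ∷ noNeighbours x x≢a x≢b (inj₁ (≢-sym x≢a , ≁-sym (fromCycle x≁a))) ,
          emb-∉ (a ∷ []) (y≢a ∷ []) offCycle , fromCycle y∼a ,
          noNeighbours y y≢a y≢b (inj₂ (y≢b , fromCycle y≁b)) , startPath)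
         (emb-∉ (x ∷ y ∷ a ∷ []) (≢-sym x≢b ∷ ≢-sym y≢b ∷ ≢-sym a≢b ∷ []) offCycle)
         (fromCycle b∼x) (fromCycle y≁b , a≁b , endOnlyLast)
         (emb z) (emb-∉ (b ∷ x ∷ y ∷ a ∷ []) (z≢b ∷ z≢x ∷ z≢y ∷ z≢a ∷ []) offCycle)
         (fromCycle z∼b) (suc (suc zero)) (fromCycle z∼a))
    where
    open MinimalBridge ad br min
    open Bridge br

  noOffCycleVertex : TwoConnected G → ¬ HasK2Cutset G → ∀ v → ¬ OffCycle C v
  noOffCycleVertex tc noCut v off =
    nonadjacentBridge tc noCut C5-triangleFree off (noAdmissibleBridge excludesMinimal)

noOffCycleVertex : ∀ G → TwoConnected G → ¬ HasK2Cutset G → ¬ ContainsPropeller G →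
                   ∀ k (p : 3 ≤ k) → k ≤ 5 → (C : InducedSub (Cycle k p) G) → ∀ v → ¬ OffCycle C v
noOffCycleVertex G tc _     noP 3 (s≤s (s≤s (s≤s z≤n))) _ C = Length3.noOffCycleVertex C noP tc
noOffCycleVertex G tc noCut noP 4 (s≤s (s≤s (s≤s z≤n))) _ C = Length4.noOffCycleVertex C noP tc noCut
noOffCycleVertex G tc noCut noP 5 (s≤s (s≤s (s≤s z≤n))) _ C = Length5.noOffCycleVertex C noP tc noCut
noOffCycleVertex G _  _     _   (suc (suc (suc (suc (suc (suc _)))))) _ (s≤s (s≤s (s≤s (s≤s (s≤s ()))))) _

lemma4p5 : (G : Graph) → TwoConnected G → ¬ HasK2Cutset G → ¬ ContainsPropeller G →
    (k : ℕ) (p : 3 ≤ k) → k ≤ 5 → InducedSub (Cycle k p) G → Iso G (Cycle k p)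
lemma4p5 G tc noCut noP k p k≤5 C = surjective-inducedSub⇒Iso C onCycle
  where
  onCycle : ∀ v → ∃ λ i → InducedSub.emb C i ≡ v
  onCycle v with any? (λ i → InducedSub.emb C i ≟ᶠ v)
  ... | yes found = found
  ... | no  off   = ⊥-elim (noOffCycleVertex G tc noCut noP k p k≤5 C v (λ i e → off (i , e)))
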